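{- Let $p,q$ be finite paths in $G_n$ of lengths $\ell,\ell'$ such that the final vertex of $p$ equals the initial vertex of $q$, and let $pq$ be their concatenation. For $1\le i,j\le\ell'+n$, if $x_i(q)\le x_j(q)$ in $Q_q$, then $x_{\ell+i}(pq)\le x_{\ell+j}(pq)$ in $Q_{pq}$.
   Context: $[k]=\{1,\dots,k\}$. For distinct reals $y_1,\dots,y_k$, $\mathrm{Order}(y_1,\dots,y_k)$ is the unique $\sigma\in S_k$ with $y_i<y_j$ iff $\sigma(i)<\sigma(j)$. $\rho,\rho':S_{n+1}\to S_n$: $\rho(\sigma)=\mathrm{Order}(\sigma(1),\dots,\sigma(n))$, $\rho'(\sigma)=\mathrm{Order}(\sigma(2),\dots,\sigma(n+1))$. The permutation digraph $G_n$ has vertex set $S_n$ and edge set $S_{n+1}$, edge $e$ directed from $\rho(e)$ to $\rho'(e)$. A path of length $\ell$ is $(v_0,e_1,v_1,\dots,e_\ell,v_\ell)$ with $e_i$ directed from $v_{i-1}$ to $v_i$. For a path $p$ of length $\ell$, $Q_p=\{x_1(p),\dots,x_{\ell+n}(p)\}$ with $\le$ the reflexive-transitive closure of: $x_{a+c}\le x_{a+d}$ when $0\le a\le\ell$, $c,d\in[n]$, $v_a(c)\le v_a(d)$; $x_{a-1+c}\le x_{a-1+d}$ when $1\le a\le\ell$, $c,d\in[n+1]$, $e_a(c)\le e_a(d)$. -}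

module Defs where

open import Data.Nat using (ℕ; zero; suc; _+_)
open import Data.Fin using (Fin; toℕ; inject₁) renaming (_≤_ to _≤ᶠ_; _<_ to _<ᶠ_)
import Data.Fin as F
open import Data.Fin.Permutation using (Permutation′; _⟨$⟩ʳ_)
open import Data.Vec using (Vec; lookup; _++_; tail)
open import Data.Product using (_×_)
open import Relation.Binary.Construct.Closure.ReflexiveTransitive using (Star)

-- S_k : permutations of Fin k (0-based stand-in for [k])
Perm : ℕ → Set
Perm = Permutation′

IsOrder : ∀ {k m} → (Fin k → Fin m) → Perm k → Set
IsOrder {k} y σ = ∀ (i j : Fin k) →
  ((y i <ᶠ y j) → (σ ⟨$⟩ʳ i <ᶠ σ ⟨$⟩ʳ j)) × ((σ ⟨$⟩ʳ i <ᶠ σ ⟨$⟩ʳ j) → (y i <ᶠ y j))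

-- ρ(e) = v   (restrict e to positions 1..n)
IsRho : ∀ {n} → Perm (suc n) → Perm n → Set
IsRho e v = IsOrder (λ c → e ⟨$⟩ʳ inject₁ c) v

-- ρ'(e) = v  (restrict e to positions 2..n+1)
IsRho' : ∀ {n} → Perm (suc n) → Perm n → Set
IsRho' e v = IsOrder (λ c → e ⟨$⟩ʳ F.suc c) v

-- Raw path data in G_n: vertices v_0,…,v_ℓ and edges e_1,…,e_ℓ
-- (verts[a] = v_a, edges[k] = e_{k+1}).
record Path (n : ℕ) : Set where
  constructor mkPath
  field
    len   : ℕ
    verts : Vec (Perm n) (suc len)
    edges : Vec (Perm (suc n)) len
open Path public

IsPath : ∀ {n} → Path n → Set
IsPath {n} p = ∀ (k : Fin (len p)) →
  IsRho (lookup (edges p) k) (lookup (verts p) (inject₁ k)) ×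
  IsRho' (lookup (edges p) k) (lookup (verts p) (F.suc k))

_⊙_ : ∀ {n} → Path n → Path n → Path n
p ⊙ q = mkPath (len p + len q) (verts p ++ tail (verts q)) (edges p ++ edges q)

-- Generating relations of Q_p on indices (1-based naturals: i stands for x_i(p)).
-- vtx: x_{a+c} ≤ x_{a+d} when v_a(c) ≤ v_a(d)  (a = toℕ a, c = 1 + toℕ c)
-- edg: x_{a-1+c} ≤ x_{a-1+d} when e_a(c) ≤ e_a(d)  (a - 1 = toℕ k)
data Gen {n : ℕ} (p : Path n) : ℕ → ℕ → Set where
  vtx : (a : Fin (suc (len p))) (c d : Fin n) →
        (lookup (verts p) a ⟨$⟩ʳ c) ≤ᶠ (lookup (verts p) a ⟨$⟩ʳ d) →
        Gen p (toℕ a + suc (toℕ c)) (toℕ a + suc (toℕ d))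
  edg : (k : Fin (len p)) (c d : Fin (suc n)) →
        (lookup (edges p) k ⟨$⟩ʳ c) ≤ᶠ (lookup (edges p) k ⟨$⟩ʳ d) →
        Gen p (toℕ k + suc (toℕ c)) (toℕ k + suc (toℕ d))

_⊢_≼_ : ∀ {n} → Path n → ℕ → ℕ → Set
p ⊢ i ≼ j = Star (Gen p) i j

-- A generating relation of Q_q comes from a vertex or an edge of q, and that
-- vertex or edge reappears in pq shifted by ℓ = len p: the edges of q follow
-- those of p, and the vertices of q follow those of p with v_0(q) glued onto
-- v_ℓ(p).  Each generator of Q_q thus becomes a generator of Q_pq with both
-- indices shifted by ℓ, and the shift carries the closure along.
module Submission where

open import Defs
open import Data.Nat using (ℕ; _+_; _≤_; suc)
open import Data.Nat.Properties using (+-assoc; +-identityʳ; +-suc)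
open import Data.Vec using (Vec; last; head; lookup; _∷_; []; tail; _++_)
open import Data.Vec.Properties using (lookup-++ˡ; lookup-++ʳ)
open import Data.Fin using (Fin; toℕ; fromℕ; _↑ˡ_; _↑ʳ_)
import Data.Fin as F
open import Data.Fin.Permutation using (_⟨$⟩ʳ_)
open import Data.Fin.Properties using (toℕ-↑ˡ; toℕ-↑ʳ; toℕ-fromℕ)
open import Relation.Binary.PropositionalEquality
  using (_≡_; refl; sym; trans; subst; subst₂; module ≡-Reasoning)
open import Relation.Binary.Construct.Closure.ReflexiveTransitive using (gmap)

private
  variable
    A : Set
    m k : ℕ

last≡lookup-fromℕ : (xs : Vec A (suc m)) → last xs ≡ lookup xs (fromℕ m)
last≡lookup-fromℕ (x ∷ [])     = refl
last≡lookup-fromℕ (x ∷ y ∷ ys) = last≡lookup-fromℕ (y ∷ ys)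

-- Position in  xs ++ tail ys  (xs of length suc m) where entry b of ys lands
-- once ys is glued onto xs along last xs ≡ head ys.
glue : ∀ m → Fin (suc k) → Fin (suc m + k)
glue {k} m F.zero    = fromℕ m ↑ˡ k
glue     m (F.suc b) = suc m ↑ʳ b

toℕ-glue : ∀ m (b : Fin (suc k)) → toℕ (glue m b) ≡ m + toℕ b
toℕ-glue {k} m F.zero    = trans (toℕ-↑ˡ (fromℕ m) k) (trans (toℕ-fromℕ m) (sym (+-identityʳ m)))
toℕ-glue     m (F.suc b) = trans (toℕ-↑ʳ (suc m) b) (sym (+-suc m (toℕ b)))

lookup-glue : (xs : Vec A (suc m)) (ys : Vec A (suc k)) → last xs ≡ head ys →
              ∀ b → lookup (xs ++ tail ys) (glue m b) ≡ lookup ys b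
lookup-glue {m = m} xs (y ∷ ys) glued F.zero = begin
  lookup (xs ++ ys) (fromℕ m ↑ˡ _)  ≡⟨ lookup-++ˡ xs ys (fromℕ m) ⟩
  lookup xs (fromℕ m)               ≡⟨ sym (last≡lookup-fromℕ xs) ⟩
  last xs                           ≡⟨ glued ⟩
  y                                 ∎
  where open ≡-Reasoning
lookup-glue xs (y ∷ ys) _ (F.suc b) = lookup-++ʳ xs ys b

module _ {n} (p q : Path n) (glued : last (verts p) ≡ head (verts q)) where

  private
    shift : ∀ {a} b x → a ≡ len p + b → a + x ≡ len p + (b + x)
    shift b x refl = +-assoc (len p) b x

  Gen-⊙ʳ : ∀ {i j} → Gen q i j → Gen (p ⊙ q) (len p + i) (len p + j)
  Gen-⊙ʳ (vtx b c d v≤) =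
    subst₂ (Gen (p ⊙ q)) (shift (toℕ b) _ (toℕ-glue (len p) b)) (shift (toℕ b) _ (toℕ-glue (len p) b))
      (vtx (glue (len p) b) c d
        (subst (λ v → v ⟨$⟩ʳ c F.≤ v ⟨$⟩ʳ d) (sym (lookup-glue (verts p) (verts q) glued b)) v≤))
  Gen-⊙ʳ (edg k c d e≤) =
    subst₂ (Gen (p ⊙ q)) (shift (toℕ k) _ (toℕ-↑ʳ (len p) k)) (shift (toℕ k) _ (toℕ-↑ʳ (len p) k))
      (edg (len p ↑ʳ k) c d
        (subst (λ e → e ⟨$⟩ʳ c F.≤ e ⟨$⟩ʳ d) (sym (lookup-++ʳ (edges p) (edges q) k)) e≤))

lemma3p6 : ∀ {n : ℕ} (p q : Path n) → IsPath p → IsPath q →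
    last (verts p) ≡ head (verts q) →
    ∀ (i j : ℕ) → 1 ≤ i → i ≤ len q + n → 1 ≤ j → j ≤ len q + n →
    q ⊢ i ≼ j → (p ⊙ q) ⊢ (len p + i) ≼ (len p + j)
lemma3p6 p q _ _ glued _ _ _ _ _ _ = gmap (len p +_) (Gen-⊙ʳ p q glued)
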